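{- Let $X$ be a connected simple graph on $n$ vertices that contains exactly one cycle subgraph, and suppose this cycle has $k$ vertices. Then $g(\mathsf{FS}(X,\text{Star}_n)) = k(k-1)$.
   Context: $g$ denotes girth. $\text{Star}_n$ is the star graph on $n$ vertices. $\mathsf{FS}(X,Y)$ has as vertices all bijections $\sigma: V(X)\to V(Y)$, with $\sigma,\sigma'$ adjacent iff there is an edge $\{a,b\}\in E(X)$ with $\{\sigma(a),\sigma(b)\}\in E(Y)$, $\sigma'(a)=\sigma(b)$, $\sigma'(b)=\sigma(a)$ and $\sigma'=\sigma$ elsewhere. -}

module Defs where

open import Data.Nat using (ℕ; zero; suc; _≤_; _*_; _∸_)
import Data.Nat as ℕ
import Data.Nat.Properties
open import Data.Fin using (Fin; zero; suc; toℕ; fromℕ; lower₁; _≟_)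
open import Data.Vec using (Vec; lookup)
open import Data.Product using (Σ; ∃; _×_; _,_)
open import Data.Sum using (_⊎_)
open import Relation.Nullary using (¬_; yes; no)
open import Relation.Binary.PropositionalEquality using (_≡_; _≢_; refl; cong)
open import Relation.Binary.Construct.Closure.ReflexiveTransitive using (Star)
open import Function.Definitions using (Injective; Surjective)

next : ∀ {m} → Fin m → Fin m
next {suc m} i with ℕ._≟_ (toℕ i) m
... | yes _ = zero
... | no ne = lower₁ (suc i) (λ eq → ne (sym' (Data.Nat.Properties.suc-injective eq)))
  where
  sym' : ∀ {a b : ℕ} → a ≡ b → b ≡ a
  sym' refl = refl

record Cycle {V : Set} (IsVertex : V → Set) (Adj : V → V → Set) (m : ℕ) : Set where
  field
    vert   : Fin m → V
    len≥3  : 3 ≤ m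
    inj    : Injective _≡_ _≡_ vert
    isVert : ∀ i → IsVertex (vert i)
    adj    : ∀ i → Adj (vert i) (vert (next i))
open Cycle public

IsGirth : {V : Set} (IsVertex : V → Set) (Adj : V → V → Set) (g : ℕ) → Set
IsGirth IsVertex Adj g =
  Cycle IsVertex Adj g × (∀ l → Cycle IsVertex Adj l → g ≤ l)

record SimpleGraph (n : ℕ) : Set₁ where
  field
    Adj    : Fin n → Fin n → Set
    sym    : ∀ {u v} → Adj u v → Adj v u
    irrefl : ∀ {u} → ¬ Adj u u
open SimpleGraph public

AllVertices : {A : Set} → A → Set
AllVertices _ = Data.Unit.⊤
  where import Data.Unit

Connected : ∀ {n} → SimpleGraph n → Set
Connected X = ∀ u v → Star (Adj X) u v

CycleEdge : ∀ {n m} {X : SimpleGraph n} →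
            Cycle AllVertices (Adj X) m → Fin n → Fin n → Set
CycleEdge {m = m} c u v =
  ∃ λ (i : Fin m) → (vert c i ≡ u × vert c (next i) ≡ v)
                  ⊎ (vert c i ≡ v × vert c (next i) ≡ u)

-- X contains exactly one cycle subgraph, and it has k vertices:
-- there is a cycle of length k, and every cycle of X (of any length)
-- has the same edge set (hence is the same subgraph).
UniqueCycleOfLength : ∀ {n} → SimpleGraph n → ℕ → Set
UniqueCycleOfLength {n} X k =
  Σ (Cycle AllVertices (Adj X) k) λ c →
    ∀ l (c' : Cycle AllVertices (Adj X) l) (u v : Fin n) →
      (CycleEdge {X = X} c u v → CycleEdge {X = X} c' u v) ×
      (CycleEdge {X = X} c' u v → CycleEdge {X = X} c u v)

StarAdj : ∀ {n} → Fin n → Fin n → Set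
StarAdj i j = (toℕ i ≡ 0 × toℕ j ≢ 0) ⊎ (toℕ j ≡ 0 × toℕ i ≢ 0)

StarGraph : (n : ℕ) → SimpleGraph n
StarGraph n = record { Adj = StarAdj ; sym = s ; irrefl = ir }
  where
  s : ∀ {u v : Fin n} → StarAdj u v → StarAdj v u
  s (Data.Sum.inj₁ p) = Data.Sum.inj₂ p
  s (Data.Sum.inj₂ p) = Data.Sum.inj₁ p
  ir : ∀ {u : Fin n} → ¬ StarAdj u u
  ir (Data.Sum.inj₁ (a , b)) = b a
  ir (Data.Sum.inj₂ (a , b)) = b a

-- A map σ : V(X) → V(Y) is represented by the vector of its values
-- (so that equality of vertices is ordinary equality); vertices of
-- FS(X,Y) are those vectors that are bijections.

IsBijection : ∀ {n} → Vec (Fin n) n → Set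
IsBijection σ = Injective _≡_ _≡_ (lookup σ) × Surjective _≡_ _≡_ (lookup σ)

SwapOf : ∀ {n} → Vec (Fin n) n → Fin n → Fin n → Vec (Fin n) n → Set
SwapOf σ a b σ' =
  lookup σ' a ≡ lookup σ b × lookup σ' b ≡ lookup σ a ×
  (∀ i → i ≢ a → i ≢ b → lookup σ' i ≡ lookup σ i)

FSAdj : ∀ {n} → SimpleGraph n → SimpleGraph n →
        Vec (Fin n) n → Vec (Fin n) n → Set
FSAdj X Y σ σ' =
  ∃ λ a → ∃ λ b → Adj X a b × Adj Y (lookup σ a) (lookup σ b) × SwapOf σ a b σ'

GirthFS : ∀ {n} → SimpleGraph n → SimpleGraph n → ℕ → Set
GirthFS X Y g = IsGirth IsBijection (FSAdj X Y) g

-- The vertex of X holding the centre of the star (the blank) trades places with a neighbour at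
-- every move of FS(X, Star_n), and two successive moves along the same edge cancel; so a cycle of
-- length L in FS(X, Star_n) makes the blank walk a closed non-backtracking walk of length L in X.
-- When C, of length k, is the only cycle of X, such a walk can only wind round C in one direction,
-- hence k ∣ L. Seen from the blank, the k − 1 tokens on C rotate by one place per move, so the
-- arrangement can only repeat when also k − 1 ∣ L; as k and k − 1 are coprime, k(k − 1) ∣ L.
-- Conversely, walking the blank k(k − 1) steps round C closes up a cycle of that length.
module Submission where

open import Data.Empty using (⊥-elim)
open import Data.Fin using (Fin; zero; suc; toℕ)
open import Data.Fin.Permutation using (Permutation′; _⟨$⟩ʳ_; _⟨$⟩ˡ_; _∘ₚ_; inverseˡ; inverseʳ)
import Data.Fin.Permutation as Permutation
open import Data.Fin.Permutation.Components using (transpose)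
import Data.Fin.Properties as Finₚ
open import Data.List using (List; []; _∷_)
import Data.List.Membership.DecPropositional as DecMembership
open import Data.List.Membership.Propositional using (_∈_; _∉_)
open import Data.List.Relation.Binary.Subset.Propositional using (_⊆_)
open import Data.List.Relation.Unary.Any using (here; there)
open import Data.Nat
open import Data.Nat.Coprimality using (Coprime; coprime-divisor; coprime-+; 1-coprimeTo)
import Data.Nat.Coprimality as Coprime
open import Data.Nat.Divisibility using (_∣_; divides; n∣m*n; ∣m+n∣m⇒∣n; *-monoʳ-∣; ∣⇒≤)
open import Data.Nat.DivMod
open import Data.Nat.Induction using (<-rec)
open import Data.Nat.Properties
open import Data.Product using (Σ-syntax; ∃; _×_; _,_; proj₁; proj₂)
open import Data.Sum using (_⊎_; inj₁; inj₂)
import Data.Sum as Sum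
open import Data.Unit using (⊤; tt)
open import Data.Vec using (Vec; lookup; tabulate)
open import Data.Vec.Properties using (lookup∘tabulate; tabulate-cong)
open import Data.Vec.Relation.Binary.Pointwise.Extensional using (ext; Pointwise-≡⇒≡)
open import Function using (_∘_)
open import Relation.Binary.Construct.Closure.ReflexiveTransitive
  using (Star; ε; _◅_; _◅◅_; revApp; reverse; return)
open import Relation.Binary.PropositionalEquality
open import Relation.Nullary using (¬_; Dec; yes; no)
open import Relation.Nullary.Decidable using (dec-true; dec-false)
open import Relation.Unary using (Decidable)

open import Defs hiding (sym)

[m+n]%o≡m%o⇒o∣n : ∀ m n o .{{_ : NonZero o}} → (m + n) % o ≡ m % o → o ∣ n
[m+n]%o≡m%o⇒o∣n m n o eq = ∣m+n∣m⇒∣n (divides ((m + n) / o) (+-cancelˡ-≡ (m % o) _ _ split)) (n∣m*n (m / o))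
  where
  open ≡-Reasoning
  split : m % o + (m / o * o + n) ≡ m % o + (m + n) / o * o
  split = begin
    m % o + (m / o * o + n)       ≡⟨ +-assoc (m % o) (m / o * o) n ⟨
    m % o + m / o * o + n         ≡⟨ cong (_+ n) (m≡m%n+[m/n]*n m o) ⟨
    m + n                         ≡⟨ m≡m%n+[m/n]*n (m + n) o ⟩
    (m + n) % o + (m + n) / o * o ≡⟨ cong (_+ (m + n) / o * o) eq ⟩
    m % o + (m + n) / o * o       ∎

%-fresh : ∀ m {d o} .{{_ : NonZero o}} → 0 < d → d < o → (m + d) % o ≢ m % o
%-fresh m {d} {o} 0<d d<o eq = <⇒≱ d<o (∣⇒≤ {{>-nonZero 0<d}} ([m+n]%o≡m%o⇒o∣n m d o eq))

[m+n%o]%o≡[m+n]%o : ∀ m n o .{{_ : NonZero o}} → (m + n % o) % o ≡ (m + n) % o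
[m+n%o]%o≡[m+n]%o m n o = begin
  (m + n % o) % o            ≡⟨ %-distribˡ-+ m (n % o) o ⟩
  (m % o + n % o % o) % o    ≡⟨ cong (λ x → (m % o + x) % o) (m%n%n≡m%n n o) ⟩
  (m % o + n % o) % o        ≡⟨ %-distribˡ-+ m n o ⟨
  (m + n) % o                ∎
  where open ≡-Reasoning

coprime⇒*∣ : ∀ {m n o} → Coprime m n → m ∣ o → n ∣ o → m * n ∣ o
coprime⇒*∣ {m} {n} c (divides q refl) n∣qm = subst (m * n ∣_) (*-comm m q) (*-monoʳ-∣ m n∣q)
  where
  n∣q : n ∣ q
  n∣q = coprime-divisor (Coprime.sym c) (subst (n ∣_) (*-comm q m) n∣qm)

suc-coprime : ∀ n → Coprime (suc n) n
suc-coprime n = subst (λ m → Coprime m n) (+-comm n 1) (coprime-+ (1-coprimeTo n))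

least : ∀ {P : ℕ → Set} → Decidable P → ∀ {N} → P N →
        Σ[ d ∈ ℕ ] d ≤ N × P d × (∀ {d′} → d′ < d → ¬ P d′)
least {P} P? {N} = <-rec Least search N
  where
  Least : ℕ → Set
  Least N = P N → Σ[ d ∈ ℕ ] d ≤ N × P d × (∀ {d′} → d′ < d → ¬ P d′)
  search : ∀ N → (∀ {M} → M < N → Least M) → Least N
  search N below pN with anyUpTo? P? N
  ... | no none = N , ≤-refl , pN , λ d′<N pd′ → none (_ , d′<N , pd′)
  ... | yes (M , M<N , pM) with below M<N pM
  ...   | d , d≤M , pd , minimal = d , ≤-trans d≤M (<⇒≤ M<N) , pd , minimal

next-last : ∀ {m} (i : Fin (suc m)) → toℕ i ≡ m → next i ≡ zero
next-last {m} i i≡m with toℕ i ≟ m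
... | yes _ = refl
... | no i≢m = ⊥-elim (i≢m i≡m)

toℕ-next-< : ∀ {m} (i : Fin (suc m)) → toℕ i ≢ m → toℕ (next i) ≡ suc (toℕ i)
toℕ-next-< {m} i i≢m with toℕ i ≟ m
... | yes i≡m = ⊥-elim (i≢m i≡m)
... | no _ = cong suc (Finₚ.toℕ-lower₁ i _)

toℕ-next : ∀ {m} (i : Fin (suc m)) → toℕ (next i) ≡ suc (toℕ i) % suc m
toℕ-next {m} i = by-cases (toℕ i ≟ m)
  where
  by-cases : Dec (toℕ i ≡ m) → toℕ (next i) ≡ suc (toℕ i) % suc m
  by-cases (yes i≡m) = trans (cong toℕ (next-last i i≡m))
                             (sym (trans (cong (λ j → suc j % suc m) i≡m) (n%n≡0 (suc m))))
  by-cases (no i≢m) = trans (toℕ-next-< i i≢m)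
                            (sym (m<n⇒m%n≡m (s≤s (≤∧≢⇒< (Finₚ.toℕ≤pred[n] i) i≢m))))

index : ∀ {m} → ℕ → Fin (suc m)
index zero = zero
index (suc t) = next (index t)

toℕ-index : ∀ {m} t → toℕ (index {m} t) ≡ t % suc m
toℕ-index zero = refl
toℕ-index {m} (suc t) = begin
  toℕ (next (index t))             ≡⟨ toℕ-next (index t) ⟩
  suc (toℕ (index {m} t)) % suc m  ≡⟨ cong (λ j → suc j % suc m) (toℕ-index t) ⟩
  suc (t % suc m) % suc m          ≡⟨ [m+n%o]%o≡[m+n]%o 1 t (suc m) ⟩
  suc t % suc m                    ∎
  where open ≡-Reasoning

index-toℕ : ∀ {m} (i : Fin (suc m)) → index (toℕ i) ≡ i
index-toℕ i = Finₚ.toℕ-injective (trans (toℕ-index (toℕ i)) (m<n⇒m%n≡m (Finₚ.toℕ<n i)))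

index-cong : ∀ {m} s t → s % suc m ≡ t % suc m → index {m} s ≡ index t
index-cong s t eq = Finₚ.toℕ-injective (trans (toℕ-index s) (trans eq (sym (toℕ-index t))))

index-injective : ∀ {m} s t → index {m} s ≡ index t → s % suc m ≡ t % suc m
index-injective s t eq = trans (sym (toℕ-index s)) (trans (cong toℕ eq) (toℕ-index t))

module _ {V : Set} {IsVertex : V → Set} {R : V → V → Set} where

  sequence→cycle : ∀ {m} (f : ℕ → V) → 2 ≤ m →
    (∀ {i j} → i ≤ m → j ≤ m → f i ≡ f j → i ≡ j) →
    (∀ {t} → t < m → R (f t) (f (suc t))) → R (f m) (f 0) →
    (∀ t → IsVertex (f t)) → Cycle IsVertex R (suc m)
  sequence→cycle {m} f 2≤m f-injective step closing isVertex = record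
    { vert   = λ i → f (toℕ i)
    ; len≥3  = s≤s 2≤m
    ; inj    = λ eq → Finₚ.toℕ-injective (f-injective (Finₚ.toℕ≤pred[n] _) (Finₚ.toℕ≤pred[n] _) eq)
    ; isVert = λ i → isVertex (toℕ i)
    ; adj    = adj′
    }
    where
    adj′ : ∀ i → R (f (toℕ i)) (f (toℕ (next i)))
    adj′ i with toℕ i ≟ m
    ... | yes i≡m = subst (λ j → R (f (toℕ i)) (f (toℕ j))) (sym (next-last i i≡m))
                          (subst (λ t → R (f t) (f 0)) (sym i≡m) closing)
    ... | no i≢m = subst (λ t → R (f (toℕ i)) (f t)) (sym (toℕ-next-< i i≢m))
                         (step (≤∧≢⇒< (Finₚ.toℕ≤pred[n] i) i≢m))

transpose-at-i : ∀ {n} (i j : Fin n) → transpose i j i ≡ j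
transpose-at-i i j rewrite dec-true (i Finₚ.≟ i) refl = refl

transpose-at-j : ∀ {n} (i j : Fin n) → transpose i j j ≡ i
transpose-at-j i j with j Finₚ.≟ i
... | yes j≡i = j≡i
... | no _ rewrite dec-true (j Finₚ.≟ j) refl = refl

transpose-other : ∀ {n} {i j k : Fin n} → k ≢ i → k ≢ j → transpose i j k ≡ k
transpose-other {i = i} {j} {k} k≢i k≢j
  rewrite dec-false (k Finₚ.≟ i) k≢i | dec-false (k Finₚ.≟ j) k≢j = refl

module _ {n : ℕ} where

  SwapOf-sym : ∀ {σ σ′ : Vec (Fin n) n} {a b} → SwapOf σ a b σ′ → SwapOf σ b a σ′
  SwapOf-sym (σ′a , σ′b , σ′i) = σ′b , σ′a , λ i i≢b i≢a → σ′i i i≢a i≢b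

  SwapOf-involutive : ∀ {σ σ′ σ″ : Vec (Fin n) n} {a b} →
                      SwapOf σ a b σ′ → SwapOf σ′ b a σ″ → σ″ ≡ σ
  SwapOf-involutive {σ} {σ′} {σ″} {a} {b} (σ′a , σ′b , σ′i) (σ″b , σ″a , σ″i) =
    Pointwise-≡⇒≡ (ext pointwise)
    where
    pointwise : ∀ i → lookup σ″ i ≡ lookup σ i
    pointwise i with i Finₚ.≟ a | i Finₚ.≟ b
    ... | yes refl | _ = trans σ″a σ′b
    ... | no _ | yes refl = trans σ″b σ′a
    ... | no i≢a | no i≢b = trans (σ″i i i≢b i≢a) (σ′i i i≢a i≢b)

  SwapOf-transpose : ∀ (f : Fin n → Fin n) a b →
                     SwapOf (tabulate f) a b (tabulate (λ x → f (transpose a b x)))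
  SwapOf-transpose f a b =
      trans (lookup∘tabulate _ a) (trans (cong f (transpose-at-i a b)) (sym (lookup∘tabulate f b)))
    , trans (lookup∘tabulate _ b) (trans (cong f (transpose-at-j a b)) (sym (lookup∘tabulate f a)))
    , λ i i≢a i≢b → trans (lookup∘tabulate _ i)
                          (trans (cong f (transpose-other i≢a i≢b)) (sym (lookup∘tabulate f i)))

record Winds {A : Set} (k : ℕ) (p : ℕ → A) : Set where
  field
    periodic : ∀ t → p (t + k) ≡ p t
    fresh    : ∀ s {d} → 0 < d → d < k → p (s + d) ≢ p s

module WindsProperties {A : Set} {k : ℕ} .{{_ : NonZero k}} {p : ℕ → A} (winds : Winds k p) where
  open Winds winds

  periodic-* : ∀ t q → p (t + q * k) ≡ p t
  periodic-* t zero = cong p (+-identityʳ t)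
  periodic-* t (suc q) = begin
    p (t + (k + q * k))  ≡⟨ cong p (trans (cong (t +_) (+-comm k (q * k))) (sym (+-assoc t (q * k) k))) ⟩
    p (t + q * k + k)    ≡⟨ periodic (t + q * k) ⟩
    p (t + q * k)        ≡⟨ periodic-* t q ⟩
    p t                  ∎
    where open ≡-Reasoning

  p[t]≡p[t%k] : ∀ t → p t ≡ p (t % k)
  p[t]≡p[t%k] t = trans (cong p (m≡m%n+[m/n]*n t k)) (periodic-* (t % k) (t / k))

  cancel-≤ : ∀ s {m m′} → m ≤ m′ → m′ < k → p (s + m) ≡ p (s + m′) → m ≡ m′
  cancel-≤ s {m} m≤m′ m′<k eq with m≤n⇒∃[o]m+o≡n m≤m′
  ... | zero , refl = sym (+-identityʳ m)
  ... | suc d , refl = ⊥-elim (fresh (s + m) z<s (m+n≤o⇒n≤o m (subst (_≤ k) (sym (+-suc m (suc d))) m′<k))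
                                 (trans (cong p (+-assoc s m (suc d))) (sym eq)))

  cancel : ∀ s {m m′} → m < k → m′ < k → p (s + m) ≡ p (s + m′) → m ≡ m′
  cancel s {m} {m′} m<k m′<k eq with ≤-total m m′
  ... | inj₁ m≤m′ = cancel-≤ s m≤m′ m′<k eq
  ... | inj₂ m′≤m = sym (cancel-≤ s m′≤m m<k (sym eq))

  cong-% : ∀ {s t} → s % k ≡ t % k → p s ≡ p t
  cong-% {s} {t} eq = trans (p[t]≡p[t%k] s) (trans (cong p eq) (sym (p[t]≡p[t%k] t)))

  injective-% : ∀ {s t} → p s ≡ p t → s % k ≡ t % k
  injective-% {s} {t} eq = cancel 0 (m%n<n s k) (m%n<n t k)
                             (trans (sym (p[t]≡p[t%k] s)) (trans eq (p[t]≡p[t%k] t)))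

-- A blank runs along p, swapping places with the token ahead of it at every step; σ t x is the
-- token at x at time t. Seen from the blank, a token d places ahead moves to d − 1, except that at
-- d = 1 it is swapped behind the blank, i.e. K places ahead. So the offsets rotate through
-- K, K − 1, …, 1, and the token starting at offset (offset i) is at offset (offset (t + i)) at time t.
module Tokens {A B : Set} (K : ℕ) .{{_ : NonZero K}} {p : ℕ → A} (winds : Winds (suc K) p)
  (σ : ℕ → A → B)
  (moves : ∀ t → σ (suc t) (p t) ≡ σ t (p (suc t)))
  (stays : ∀ t x → x ≢ p t → x ≢ p (suc t) → σ (suc t) x ≡ σ t x) where
  open Winds winds
  open ≡-Reasoning

  offset : ℕ → ℕ
  offset s = K ∸ s % K

  offset≤K : ∀ s → offset s ≤ K
  offset≤K s = m∸n≤m K (s % K)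

  offset-injective : ∀ {s s′} → offset s ≡ offset s′ → s % K ≡ s′ % K
  offset-injective {s} {s′} = ∸-cancelˡ-≡ (m%n≤n s K) (m%n≤n s′ K)

  offset-step : ∀ s → (offset s ≡ suc (offset (suc s)) × 0 < offset (suc s))
                    ⊎ (offset s ≡ 1 × offset (suc s) ≡ K)
  offset-step s with m≤n⇒m<n∨m≡n (m%n<n s K)
  ... | inj₁ 1+r<K = inj₁ (trans (+-∸-assoc 1 (<⇒≤ 1+r<K)) (cong (λ r → suc (K ∸ r)) (sym next-r))
                          , subst (λ r → 0 < K ∸ r) (sym next-r) (m<n⇒0<n∸m 1+r<K))
    where
    next-r : suc s % K ≡ suc (s % K)
    next-r = trans (sym ([m+n%o]%o≡[m+n]%o 1 s K)) (m<n⇒m%n≡m 1+r<K)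
  ... | inj₂ 1+r≡K = inj₂ (trans (cong (_∸ s % K) (sym 1+r≡K)) (m+n∸n≡m 1 (s % K))
                          , cong (K ∸_) next-r)
    where
    next-r : suc s % K ≡ 0
    next-r = trans (sym ([m+n%o]%o≡[m+n]%o 1 s K)) (trans (cong (_% K) 1+r≡K) (n%n≡0 K))

  token : ∀ i t → σ t (p (t + offset (t + i))) ≡ σ 0 (p (offset i))
  token i zero = refl
  token i (suc t) with offset-step (t + i)
  ... | inj₁ (o≡1+o′ , 0<o′) = begin
    σ (suc t) (p (suc t + o′))         ≡⟨ cong (σ (suc t) ∘ p) (sym (+-suc t o′)) ⟩
    σ (suc t) (p (t + suc o′))         ≡⟨ stays t _ (fresh t z<s (s≤s 1+o′≤K))
                                                    (λ eq → fresh (suc t) 0<o′ (s≤s (<⇒≤ 1+o′≤K))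
                                                               (trans (cong p (sym (+-suc t o′))) eq)) ⟩
    σ t (p (t + suc o′))               ≡⟨ cong (λ o → σ t (p (t + o))) (sym o≡1+o′) ⟩
    σ t (p (t + offset (t + i)))       ≡⟨ token i t ⟩
    σ 0 (p (offset i))                 ∎
    where
    o′ : ℕ
    o′ = offset (suc t + i)
    1+o′≤K : suc o′ ≤ K
    1+o′≤K = subst (_≤ K) o≡1+o′ (offset≤K (t + i))
  ... | inj₂ (o≡1 , o′≡K) = begin
    σ (suc t) (p (suc t + offset (suc t + i)))  ≡⟨ cong (λ o → σ (suc t) (p (suc t + o))) o′≡K ⟩
    σ (suc t) (p (suc t + K))                   ≡⟨ cong (σ (suc t) ∘ p) (sym (+-suc t K)) ⟩
    σ (suc t) (p (t + suc K))                   ≡⟨ cong (σ (suc t)) (periodic t) ⟩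
    σ (suc t) (p t)                             ≡⟨ moves t ⟩
    σ t (p (suc t))                             ≡⟨ cong (σ t ∘ p) (+-comm 1 t) ⟩
    σ t (p (t + 1))                             ≡⟨ cong (λ o → σ t (p (t + o))) (sym o≡1) ⟩
    σ t (p (t + offset (t + i)))                ≡⟨ token i t ⟩
    σ 0 (p (offset i))                          ∎

  token₀ : ∀ t → σ t (p (t + offset t)) ≡ σ 0 (p (offset 0))
  token₀ t = subst (λ s → σ t (p (t + offset s)) ≡ σ 0 (p (offset 0))) (+-identityʳ t) (token 0 t)

module Walks {n : ℕ} (X : SimpleGraph n) where
  open DecMembership (Finₚ._≟_ {n}) using (_∈?_)

  Walk : Fin n → Fin n → Set
  Walk = Star (Adj X)

  vertices : ∀ {x y} → Walk x y → List (Fin n)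
  vertices {x} ε = x ∷ []
  vertices {x} (_ ◅ w) = x ∷ vertices w

  length : ∀ {x y} → Walk x y → ℕ
  length ε = 0
  length (_ ◅ w) = suc (length w)

  -- Constantly the last vertex beyond the end of the walk.
  vertexAt : ∀ {x y} → Walk x y → ℕ → Fin n
  vertexAt {x} ε _ = x
  vertexAt {x} (_ ◅ w) zero = x
  vertexAt (_ ◅ w) (suc l) = vertexAt w l

  vertexAt-zero : ∀ {x y} (w : Walk x y) → vertexAt w 0 ≡ x
  vertexAt-zero ε = refl
  vertexAt-zero (_ ◅ w) = refl

  vertexAt-length : ∀ {x y} (w : Walk x y) → vertexAt w (length w) ≡ y
  vertexAt-length ε = refl
  vertexAt-length (_ ◅ w) = vertexAt-length w

  vertexAt-adj : ∀ {x y} (w : Walk x y) {l} → l < length w → Adj X (vertexAt w l) (vertexAt w (suc l))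
  vertexAt-adj (e ◅ w) {zero} _ = subst (Adj X _) (sym (vertexAt-zero w)) e
  vertexAt-adj (_ ◅ w) {suc l} (s≤s l<len) = vertexAt-adj w l<len

  vertexAt-∈ : ∀ {x y} (w : Walk x y) {l} → l ≤ length w → vertexAt w l ∈ vertices w
  vertexAt-∈ ε z≤n = here refl
  vertexAt-∈ (_ ◅ w) {zero} _ = here refl
  vertexAt-∈ (_ ◅ w) {suc l} (s≤s l≤len) = there (vertexAt-∈ w l≤len)

  start-∈ : ∀ {x y} (w : Walk x y) → x ∈ vertices w
  start-∈ ε = here refl
  start-∈ (_ ◅ w) = here refl

  ∈-◅◅ : ∀ {x y z} (w : Walk x y) (w′ : Walk y z) {u} →
         u ∈ vertices (w ◅◅ w′) → u ∈ vertices w ⊎ u ∈ vertices w′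
  ∈-◅◅ ε w′ u∈ = inj₂ u∈
  ∈-◅◅ (_ ◅ w) w′ (here refl) = inj₁ (here refl)
  ∈-◅◅ (_ ◅ w) w′ (there u∈) = Sum.map₁ there (∈-◅◅ w w′ u∈)

  ∈-revApp : ∀ {x y z} (w : Walk y x) (acc : Walk y z) {u} →
             u ∈ vertices (revApp (SimpleGraph.sym X) w acc) → u ∈ vertices w ⊎ u ∈ vertices acc
  ∈-revApp ε acc u∈ = inj₂ u∈
  ∈-revApp (_ ◅ w) acc u∈ with ∈-revApp w _ u∈
  ... | inj₁ u∈w = inj₁ (there u∈w)
  ... | inj₂ (here refl) = inj₁ (there (start-∈ w))
  ... | inj₂ (there u∈acc) = inj₂ u∈acc

  ∈-reverse : ∀ {x y} (w : Walk x y) {u} → u ∈ vertices (reverse (SimpleGraph.sym X) w) → u ∈ vertices w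
  ∈-reverse w u∈ with ∈-revApp w ε u∈
  ... | inj₁ u∈w = u∈w
  ... | inj₂ (here refl) = start-∈ w

  IsPath : ∀ {x y} → Walk x y → Set
  IsPath ε = ⊤
  IsPath {x} (_ ◅ w) = x ∉ vertices w × IsPath w

  vertexAt-injective : ∀ {x y} (w : Walk x y) → IsPath w → ∀ {l l′} → l ≤ length w → l′ ≤ length w →
                       vertexAt w l ≡ vertexAt w l′ → l ≡ l′
  vertexAt-injective ε _ z≤n z≤n _ = refl
  vertexAt-injective (_ ◅ w) _ {zero} {zero} _ _ _ = refl
  vertexAt-injective (_ ◅ w) (x∉w , _) {zero} {suc l′} _ (s≤s l′≤len) eq =
    ⊥-elim (x∉w (subst (_∈ vertices w) (sym eq) (vertexAt-∈ w l′≤len)))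
  vertexAt-injective (_ ◅ w) (x∉w , _) {suc l} {zero} (s≤s l≤len) _ eq =
    ⊥-elim (x∉w (subst (_∈ vertices w) eq (vertexAt-∈ w l≤len)))
  vertexAt-injective (_ ◅ w) (_ , path) {suc l} {suc l′} (s≤s l≤len) (s≤s l′≤len) eq =
    cong suc (vertexAt-injective w path l≤len l′≤len eq)

  suffixFrom : ∀ {x y u} (w : Walk x y) → u ∈ vertices w → IsPath w →
               Σ[ w′ ∈ Walk u y ] IsPath w′ × vertices w′ ⊆ vertices w
  suffixFrom ε (here refl) _ = ε , tt , λ u∈ → u∈
  suffixFrom (e ◅ w) (here refl) path = e ◅ w , path , λ u∈ → u∈
  suffixFrom (_ ◅ w) (there u∈w) (_ , path) with suffixFrom w u∈w path
  ... | w′ , path′ , w′⊆w = w′ , path′ , λ u∈ → there (w′⊆w u∈)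

  toPath : ∀ {x y} (w : Walk x y) → Σ[ w′ ∈ Walk x y ] IsPath w′ × vertices w′ ⊆ vertices w
  toPath ε = ε , tt , λ u∈ → u∈
  toPath {x} (e ◅ w) with toPath w
  ... | w′ , path′ , w′⊆w with x ∈? vertices w′
  ...   | yes x∈w′ = let w″ , path″ , w″⊆w′ = suffixFrom w′ x∈w′ path′
                     in w″ , path″ , λ u∈ → there (w′⊆w (w″⊆w′ u∈))
  ...   | no x∉w′ = e ◅ w′ , (x∉w′ , path′) , λ { (here refl) → here refl ; (there u∈) → there (w′⊆w u∈) }

  length-pos : ∀ {x y} → x ≢ y → (w : Walk x y) → 0 < length w
  length-pos x≢x ε = ⊥-elim (x≢x refl)
  length-pos _ (_ ◅ _) = z<s

  cycle-through : ∀ {v x y} → Adj X v x → Adj X v y → x ≢ y → (w : Walk x y) → v ∉ vertices w →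
                  Σ[ l ∈ ℕ ] Σ[ c′ ∈ Cycle AllVertices (Adj X) l ] CycleEdge {X = X} c′ v x
  cycle-through {v} {x} {y} vx vy x≢y w v∉w with toPath w
  ... | P , path , P⊆w = suc (length closed) , c′ , zero , inj₁ (refl , second-vertex)
    where
    closed : Walk v y
    closed = vx ◅ P
    c′ : Cycle AllVertices (Adj X) (suc (length closed))
    c′ = sequence→cycle (vertexAt closed) (s≤s (length-pos x≢y P))
           (vertexAt-injective closed ((λ v∈P → v∉w (P⊆w v∈P)) , path))
           (vertexAt-adj closed)
           (subst₂ (Adj X) (sym (vertexAt-length closed)) refl (SimpleGraph.sym X vy))
           (λ _ → tt)
    second-vertex : vert c′ (next zero) ≡ x
    second-vertex = trans (cong (vertexAt closed) (toℕ-next-< {suc (length P)} zero (λ ())))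
                          (vertexAt-zero P)

  module _ (q : ℕ → Fin n) (q-adj : ∀ t → Adj X (q t) (q (suc t))) where

    prefix : ∀ m → Walk (q 0) (q m)
    prefix zero = ε
    prefix (suc m) = prefix m ◅◅ return (q-adj m)

    ∈-prefix : ∀ m {u} → u ∈ vertices (prefix m) → ∃ λ l → l ≤ m × u ≡ q l
    ∈-prefix zero (here refl) = 0 , z≤n , refl
    ∈-prefix (suc m) u∈ with ∈-◅◅ (prefix m) _ u∈
    ... | inj₁ u∈prefix = let l , l≤m , eq = ∈-prefix m u∈prefix in l , m≤n⇒m≤1+n l≤m , eq
    ... | inj₂ (here refl) = m , n≤1+n m , refl
    ... | inj₂ (there (here refl)) = suc m , ≤-refl , refl

  record NonBacktracking (q : ℕ → Fin n) : Set where
    field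
      step      : ∀ t → Adj X (q t) (q (suc t))
      no-return : ∀ t → q (suc (suc t)) ≢ q t

  nonBacktracking-suc : ∀ {q} → NonBacktracking q → NonBacktracking (λ l → q (suc l))
  nonBacktracking-suc nb = record { step = λ t → step (suc t) ; no-return = λ t → no-return (suc t) }
    where open NonBacktracking nb

  nonBacktracking-shift : ∀ {q} → NonBacktracking q → ∀ a → NonBacktracking (λ l → q (l + a))
  nonBacktracking-shift nb a = record { step = λ t → step (t + a) ; no-return = λ t → no-return (t + a) }
    where open NonBacktracking nb

module UniqueCycle {n : ℕ} (X : SimpleGraph n) {K : ℕ}
  (c : Cycle AllVertices (Adj X) (suc K))
  (contains-all-cycles : ∀ {l} (c′ : Cycle AllVertices (Adj X) l) {u v} →
                         CycleEdge {X = X} c′ u v → CycleEdge {X = X} c u v) where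
  open Walks X

  k : ℕ
  k = suc K

  Edge : Fin n → Fin n → Set
  Edge = CycleEdge {X = X} c

  OnCycle : Fin n → Set
  OnCycle u = ∃ λ i → vert c i ≡ u

  onCycle? : ∀ u → Dec (OnCycle u)
  onCycle? u = Finₚ.any? (λ i → vert c i Finₚ.≟ u)

  edge⇒onCycle : ∀ {u w} → Edge u w → OnCycle u
  edge⇒onCycle (i , inj₁ (vi≡u , _)) = i , vi≡u
  edge⇒onCycle (i , inj₂ (_ , vi+1≡u)) = next i , vi+1≡u

  closing-edge : ∀ {v x y} → Adj X v x → Adj X v y → x ≢ y → (w : Walk x y) → v ∉ vertices w → Edge v x
  closing-edge vx vy x≢y w v∉w = let _ , c′ , edge = cycle-through vx vy x≢y w v∉w
                                 in contains-all-cycles c′ edge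

  closing-edge′ : ∀ {v x y} → Adj X v x → Adj X v y → x ≢ y → (w : Walk x y) → v ∉ vertices w → Edge v y
  closing-edge′ vx vy x≢y w v∉w =
    closing-edge vy vx (λ y≡x → x≢y (sym y≡x)) (reverse (SimpleGraph.sym X) w) (λ v∈ → v∉w (∈-reverse w v∈))

  at : ℕ → Fin n
  at j = vert c (index j)

  at-adj : ∀ j → Adj X (at j) (at (suc j))
  at-adj j = adj c (index j)

  at-onCycle : ∀ j → OnCycle (at j)
  at-onCycle j = index j , refl

  vert≡at : ∀ i → vert c i ≡ at (toℕ i)
  vert≡at i = cong (vert c) (sym (index-toℕ i))

  onCycle⇒at : ∀ {u} → OnCycle u → ∃ λ a → a < k × u ≡ at a
  onCycle⇒at (i , refl) = toℕ i , Finₚ.toℕ<n i , vert≡at i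

  at-winds : Winds k at
  at-winds = record
    { periodic = λ t → cong (vert c) (index-cong (t + k) t ([m+n]%n≡m%n t k))
    ; fresh    = λ s 0<d d<k eq → %-fresh s 0<d d<k (index-injective (s + _) s (inj c eq))
    }

  open Winds at-winds public using () renaming (periodic to at-periodic; fresh to at-fresh)

  at-suc-cong : ∀ {x y} → at x ≡ at y → at (suc x) ≡ at (suc y)
  at-suc-cong {x} {y} eq = cong (vert c ∘ next) (inj c {index x} {index y} eq)

  at-+-cong : ∀ m {x y} → at x ≡ at y → at (m + x) ≡ at (m + y)
  at-+-cong zero eq = eq
  at-+-cong (suc m) {x} {y} eq = at-suc-cong {m + x} {m + y} (at-+-cong m eq)

  at-suc-injective : ∀ {x y} → at (suc x) ≡ at (suc y) → at x ≡ at y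
  at-suc-injective {x} {y} eq = begin
    at x            ≡⟨ at-periodic x ⟨
    at (x + k)      ≡⟨ cong at (trans (+-suc x K) (+-comm (suc x) K)) ⟩
    at (K + suc x)  ≡⟨ at-+-cong K eq ⟩
    at (K + suc y)  ≡⟨ cong at (trans (+-comm K (suc y)) (sym (+-suc y K))) ⟩
    at (y + k)      ≡⟨ at-periodic y ⟩
    at y            ∎
    where open ≡-Reasoning

  Along : Fin n → Fin n → Set
  Along u w = ∃ λ a → u ≡ at a × w ≡ at (suc a)

  edge⇒along : ∀ {u w} → Edge u w → Along u w ⊎ Along w u
  edge⇒along (i , inj₁ (refl , refl)) = inj₁ (toℕ i , vert≡at i , cong (vert c ∘ next) (sym (index-toℕ i)))
  edge⇒along (i , inj₂ (refl , refl)) = inj₂ (toℕ i , vert≡at i , cong (vert c ∘ next) (sym (index-toℕ i)))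

  arc : ∀ {u w} → OnCycle u → OnCycle w → Σ[ W ∈ Walk u w ] (∀ {z} → z ∈ vertices W → OnCycle z)
  arc on-u on-w with onCycle⇒at on-u | onCycle⇒at on-w
  ... | a , a<k , refl | b , _ , refl =
    subst (λ y → Σ[ W ∈ Walk (at a) y ] (∀ {z} → z ∈ vertices W → OnCycle z)) lands (W , on-W)
    where
    W : Walk (at a) (at (b + (k ∸ a) + a))
    W = prefix (λ l → at (l + a)) (λ l → at-adj (l + a)) (b + (k ∸ a))
    lands : at (b + (k ∸ a) + a) ≡ at b
    lands = trans (cong at (trans (+-assoc b (k ∸ a) a) (cong (b +_) (m∸n+n≡m (<⇒≤ a<k))))) (at-periodic b)
    on-W : ∀ {z} → z ∈ vertices W → OnCycle z
    on-W z∈ with ∈-prefix (λ l → at (l + a)) (λ l → at-adj (l + a)) (b + (k ∸ a)) z∈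
    ... | l , _ , refl = at-onCycle (l + a)

  adjacent-ahead⇒edge : ∀ a m → m < K → Adj X (at a) (at (m + suc a)) → Edge (at a) (at (m + suc a))
  adjacent-ahead⇒edge a zero _ _ = index a , inj₁ (refl , refl)
  adjacent-ahead⇒edge a (suc m) 1+m<K chord = closing-edge′ (at-adj a) chord short W avoid
    where
    q : ℕ → Fin n
    q l = at (l + suc a)
    W : Walk (at (suc a)) (at (suc m + suc a))
    W = prefix q (λ l → at-adj (l + suc a)) (suc m)
    short : at (suc a) ≢ at (suc m + suc a)
    short eq = at-fresh (suc a) z<s (s≤s (<⇒≤ 1+m<K)) (trans (cong at (+-comm (suc a) (suc m))) (sym eq))
    avoid : at a ∉ vertices W
    avoid a∈ with ∈-prefix q (λ l → at-adj (l + suc a)) (suc m) a∈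
    ... | l , l≤1+m , eq = at-fresh a z<s (s≤s (≤-trans (s≤s l≤1+m) 1+m<K))
                             (trans (cong at (trans (+-comm a (suc l)) (sym (+-suc l a)))) (sym eq))

  adjacent⇒edge : ∀ {u w} → OnCycle u → OnCycle w → Adj X u w → Edge u w
  adjacent⇒edge on-u on-w uw with onCycle⇒at on-u | onCycle⇒at on-w
  ... | a , a<k , refl | b , _ , refl =
    subst (Edge (at a)) lands (adjacent-ahead⇒edge a m m<K (subst (Adj X (at a)) (sym lands) uw))
    where
    open WindsProperties at-winds using (cong-%)
    m : ℕ
    m = (b + (k ∸ suc a)) % k
    lands : at (m + suc a) ≡ at b
    lands = cong-% {m + suc a} {b} (begin
      (m + suc a) % k                     ≡⟨ cong (_% k) (+-comm m (suc a)) ⟩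
      (suc a + m) % k                     ≡⟨ [m+n%o]%o≡[m+n]%o (suc a) (b + (k ∸ suc a)) k ⟩
      (suc a + (b + (k ∸ suc a))) % k     ≡⟨ cong (_% k) (+-comm (suc a) (b + (k ∸ suc a))) ⟩
      (b + (k ∸ suc a) + suc a) % k       ≡⟨ cong (_% k) (+-assoc b (k ∸ suc a) (suc a)) ⟩
      (b + (k ∸ suc a + suc a)) % k       ≡⟨ cong (λ x → (b + x) % k) (m∸n+n≡m a<k) ⟩
      (b + k) % k                         ≡⟨ [m+n]%n≡m%n b k ⟩
      b % k                               ∎)
      where open ≡-Reasoning
    m<K : m < K
    m<K with m≤n⇒m<n∨m≡n (s≤s⁻¹ (m%n<n (b + (k ∸ suc a)) k))
    ... | inj₁ m<K = m<K
    ... | inj₂ m≡K = ⊥-elim (SimpleGraph.irrefl X (subst (Adj X (at a)) b≡a uw))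
      where
      b≡a : at b ≡ at a
      b≡a = trans (sym lands) (trans (cong (λ x → at (x + suc a)) m≡K)
                  (trans (cong at (trans (+-suc K a) (+-comm k a))) (at-periodic a)))

  module _ {q : ℕ → Fin n} (nb : NonBacktracking q) where
    open NonBacktracking nb

    first-repetition-onCycle : ∀ i o → q i ≡ q (o + suc i) →
      (∀ {i′ j′} → i′ < j′ → j′ < o + suc i → q i′ ≢ q j′) → OnCycle (q i)
    first-repetition-onCycle i zero eq _ =
      ⊥-elim (SimpleGraph.irrefl X (subst (Adj X (q i)) (sym eq) (step i)))
    first-repetition-onCycle i (suc zero) eq _ = ⊥-elim (no-return i (sym eq))
    first-repetition-onCycle i (suc (suc m)) eq first = edge⇒onCycle (closing-edge (step i) vy x≢y W avoid)
      where
      vy : Adj X (q i) (q (suc m + suc i))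
      vy = SimpleGraph.sym X (subst (Adj X _) (sym eq) (step (suc m + suc i)))
      x≢y : q (suc i) ≢ q (suc m + suc i)
      x≢y = first (s≤s (m≤n+m (suc i) m)) ≤-refl
      W : Walk (q (suc i)) (q (suc m + suc i))
      W = prefix (λ l → q (l + suc i)) (λ l → step (l + suc i)) (suc m)
      avoid : q i ∉ vertices W
      avoid qi∈ with ∈-prefix (λ l → q (l + suc i)) (λ l → step (l + suc i)) (suc m) qi∈
      ... | l , l≤1+m , eq′ = first (m≤n+m (suc i) l) (s≤s (+-monoˡ-≤ (suc i) l≤1+m)) eq′

    cycle-reached : ∀ {M} → 0 < M → q M ≡ q 0 → ∃ λ l → l ≤ M × OnCycle (q l)
    cycle-reached {M} 0<M qM≡q0 with least (λ j → anyUpTo? (λ i → q i Finₚ.≟ q j) j) (0 , 0<M , sym qM≡q0)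
    ... | j , j≤M , (i , i<j , qi≡qj) , minimal =
      i , ≤-trans (<⇒≤ i<j) j≤M , first-repetition-onCycle i (j ∸ suc i) (trans qi≡qj (cong q (sym j≡)))
                                    (λ i′<j′ j′< eq → minimal (subst (_ <_) j≡ j′<) (_ , i′<j′ , eq))
      where
      j≡ : j ∸ suc i + suc i ≡ j
      j≡ = m∸n+n≡m i<j

  record Excursion (q : ℕ → Fin n) : Set where
    field
      d            : ℕ
      returns      : q (suc d) ≡ q 0
      returns-via  : q d ≡ q 1
      hit          : ℕ
      hit-onCycle  : OnCycle (q (suc hit))
      away         : ∀ {l} → l ≤ hit → q (suc l) ≢ q 0

  -- If q 0 is off the cycle, the walk must come back to q 0 along the edge it left by, for
  -- otherwise the edge q 0 q 1 would close a cycle through q 0.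
  excursion : ∀ {q} → NonBacktracking q → ¬ OnCycle (q 0) → ∀ {M} → 0 < M → q M ≡ q 0 → Excursion q
  excursion {q} nb off {suc M} _ qM≡q0 with least (λ d → q (suc d) Finₚ.≟ q 0) qM≡q0
  ... | d , _ , returns , minimal = go d returns minimal
    where
    open NonBacktracking nb
    go : ∀ d → q (suc d) ≡ q 0 → (∀ {d′} → d′ < d → q (suc d′) ≢ q 0) → Excursion q
    go zero returns _ = ⊥-elim (SimpleGraph.irrefl X (subst (Adj X (q 0)) returns (step 0)))
    go (suc zero) returns _ = ⊥-elim (no-return 0 returns)
    go (suc (suc d)) returns minimal with q (suc (suc d)) Finₚ.≟ q 1
    ... | no x≢y = ⊥-elim (off (edge⇒onCycle (closing-edge (step 0) vy (λ eq → x≢y (sym eq)) W avoid)))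
      where
      vy : Adj X (q 0) (q (suc (suc d)))
      vy = SimpleGraph.sym X (subst (Adj X _) returns (step (suc (suc d))))
      W : Walk (q 1) (q (suc (suc d)))
      W = prefix (λ l → q (suc l)) (λ l → step (suc l)) (suc d)
      avoid : q 0 ∉ vertices W
      avoid q0∈ with ∈-prefix (λ l → q (suc l)) (λ l → step (suc l)) (suc d) q0∈
      ... | l , l≤1+d , eq = minimal (s≤s l≤1+d) (sym eq)
    ... | yes returns-via with cycle-reached (nonBacktracking-suc nb) {suc d} z<s returns-via
    ...   | hit , hit≤1+d , hit-onCycle = record
      { d = suc (suc d) ; returns = returns ; returns-via = returns-via
      ; hit = hit ; hit-onCycle = hit-onCycle
      ; away = λ l≤hit → minimal (s≤s (≤-trans l≤hit hit≤1+d)) }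

  module _ {p : ℕ → Fin n} (nb : NonBacktracking p) {L : ℕ} (0<L : 0 < L)
           (closed : ∀ t → p (L + t) ≡ p t) where
    open NonBacktracking nb

    -- Were p t off the cycle, two consecutive excursions from it would leave along different
    -- edges and both reach the cycle; joining them through the cycle gives a cycle through p t.
    all-onCycle : ∀ t → OnCycle (p t)
    all-onCycle t with onCycle? (p t)
    ... | yes on = on
    ... | no off = ⊥-elim (off (edge⇒onCycle (closing-edge (step t) vy x≢y total avoid)))
      where
      q₁ : ℕ → Fin n
      q₁ l = p (l + t)
      E₁ : Excursion q₁
      E₁ = excursion (nonBacktracking-shift nb t) off 0<L (closed t)
      open Excursion E₁ using (d; returns; returns-via)
        renaming (hit to hit₁; hit-onCycle to hit₁-onCycle; away to away₁)
      s : ℕ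
      s = suc d + t
      q₂ : ℕ → Fin n
      q₂ l = p (l + s)
      E₂ : Excursion q₂
      E₂ = excursion (nonBacktracking-shift nb s) (λ on → off (subst OnCycle returns on)) 0<L (closed s)
      open Excursion E₂ using () renaming (hit to hit₂; hit-onCycle to hit₂-onCycle; away to away₂)
      W₁ : Walk (p (suc t)) (q₁ (suc hit₁))
      W₁ = prefix (λ l → q₁ (suc l)) (λ l → step (suc l + t)) hit₁
      W₂ : Walk (p (suc s)) (q₂ (suc hit₂))
      W₂ = prefix (λ l → q₂ (suc l)) (λ l → step (suc l + s)) hit₂
      through : Walk (q₁ (suc hit₁)) (q₂ (suc hit₂))
      through = proj₁ (arc hit₁-onCycle hit₂-onCycle)
      total : Walk (p (suc t)) (p (suc s))
      total = W₁ ◅◅ through ◅◅ reverse (SimpleGraph.sym X) W₂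
      vy : Adj X (p t) (p (suc s))
      vy = subst (λ x → Adj X x (p (suc s))) returns (step s)
      x≢y : p (suc t) ≢ p (suc s)
      x≢y eq = no-return (d + t) (trans (sym eq) (sym returns-via))
      avoid : p t ∉ vertices total
      avoid pt∈ with ∈-◅◅ W₁ _ pt∈
      ... | inj₁ pt∈W₁ with ∈-prefix (λ l → q₁ (suc l)) (λ l → step (suc l + t)) hit₁ pt∈W₁
      ...   | l , l≤hit , eq = away₁ l≤hit (sym eq)
      avoid pt∈ | inj₂ pt∈rest with ∈-◅◅ through _ pt∈rest
      ... | inj₁ pt∈through = off (proj₂ (arc hit₁-onCycle hit₂-onCycle) pt∈through)
      ... | inj₂ pt∈W₂ with ∈-prefix (λ l → q₂ (suc l)) (λ l → step (suc l + s)) hit₂ (∈-reverse W₂ pt∈W₂)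
      ...   | l , l≤hit , eq = away₂ l≤hit (trans (sym eq) (sym returns))

    position : ∀ t → ∃ λ a → p t ≡ at a
    position t with onCycle⇒at (all-onCycle t)
    ... | a , _ , pt≡ = a , pt≡

    steps-along : ∀ t → Along (p t) (p (suc t)) ⊎ Along (p (suc t)) (p t)
    steps-along t = edge⇒along (adjacent⇒edge (all-onCycle t) (all-onCycle (suc t)) (step t))

    forward-persists : ∀ t → Along (p t) (p (suc t)) → Along (p (suc t)) (p (suc (suc t)))
    forward-persists t (a , pt≡ , p1≡) with steps-along (suc t)
    ... | inj₁ forward = forward
    ... | inj₂ (b , p2≡ , p1≡′) =
      ⊥-elim (no-return t (trans p2≡ (trans (sym (at-suc-injective {a} {b} (trans (sym p1≡) p1≡′)))
                                             (sym pt≡))))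

    backward-persists : ∀ t → Along (p (suc t)) (p t) → Along (p (suc (suc t))) (p (suc t))
    backward-persists t (b , p1≡ , pt≡) with steps-along (suc t)
    ... | inj₂ backward = backward
    ... | inj₁ (a , p1≡′ , p2≡) =
      ⊥-elim (no-return t (trans p2≡ (trans (at-suc-cong {a} {b} (trans (sym p1≡′) p1≡)) (sym pt≡))))

    forward-position : (∀ t → Along (p t) (p (suc t))) → ∀ {t a} m → p t ≡ at a → p (t + m) ≡ at (m + a)
    forward-position _ {t} zero pt≡ = trans (cong p (+-identityʳ t)) pt≡
    forward-position fwd {t} {a} (suc m) pt≡ with fwd (t + m)
    ... | b , ptm≡ , ptm1≡ =
      trans (cong p (+-suc t m)) (trans ptm1≡ (at-suc-cong {b} {m + a} (trans (sym ptm≡) (forward-position fwd m pt≡))))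

    backward-position : (∀ t → Along (p (suc t)) (p t)) → ∀ {t a} m → p (t + m) ≡ at a → p t ≡ at (m + a)
    backward-position _ {t} zero ptm≡ = trans (cong p (sym (+-identityʳ t))) ptm≡
    backward-position bwd {t} {a} (suc m) ptm≡ with bwd (t + m)
    ... | b , ptm1≡ , ptm≡′ =
      trans (backward-position bwd m ptm≡′) (trans (cong at (+-suc m b)) (at-suc-cong {m + b} {m + a} (at-+-cong m b≡a)))
      where
      b≡a : at b ≡ at a
      b≡a = trans (sym ptm1≡) (trans (cong p (sym (+-suc t m))) ptm≡)

    -- The walk cannot turn around on the cycle, so it goes round it in one direction.
    winds : Winds k p
    winds with steps-along 0
    ... | inj₁ along₀ = record
      { periodic = λ t → let a , pt≡ = position t in
          trans (forward-position fwd k pt≡) (trans (cong at (+-comm k a)) (trans (at-periodic a) (sym pt≡)))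
      ; fresh = λ s {d} 0<d d<k eq → let a , ps≡ = position s in
          at-fresh a 0<d d<k
            (trans (cong at (+-comm a d)) (trans (sym (forward-position fwd d ps≡)) (trans eq ps≡)))
      }
      where
      fwd : ∀ t → Along (p t) (p (suc t))
      fwd zero = along₀
      fwd (suc t) = forward-persists t (fwd t)
    ... | inj₂ along₀ = record
      { periodic = λ t → let a , ptk≡ = position (t + k) in
          trans ptk≡ (sym (trans (backward-position bwd k ptk≡) (trans (cong at (+-comm k a)) (at-periodic a))))
      ; fresh = λ s {d} 0<d d<k eq → let a , psd≡ = position (s + d) in
          at-fresh a 0<d d<k
            (trans (cong at (+-comm a d)) (trans (sym (backward-position bwd d psd≡)) (trans (sym eq) psd≡)))
      }
      where
      bwd : ∀ t → Along (p (suc t)) (p t)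
      bwd zero = along₀
      bwd (suc t) = backward-persists t (bwd t)

module StarMoves {N : ℕ} (X : SimpleGraph (suc N)) where

  Arrangement : Set
  Arrangement = Vec (Fin (suc N)) (suc N)

  blank : (σ : Arrangement) → IsBijection σ → Fin (suc N)
  blank _ (_ , surjective) = proj₁ (surjective zero)

  blank-value : ∀ σ (σ-bij : IsBijection σ) → lookup σ (blank σ σ-bij) ≡ zero
  blank-value _ (_ , surjective) = proj₂ (surjective zero) refl

  blank-unique : ∀ σ (σ-bij : IsBijection σ) {x} → toℕ (lookup σ x) ≡ 0 → x ≡ blank σ σ-bij
  blank-unique σ σ-bij@(injective , _) σx≡0 =
    injective (trans (Finₚ.toℕ-injective σx≡0) (sym (blank-value σ σ-bij)))

  star-move : ∀ {σ σ′ : Arrangement} (σ-bij : IsBijection σ) (σ′-bij : IsBijection σ′) →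
    FSAdj X (StarGraph (suc N)) σ σ′ →
    Adj X (blank σ σ-bij) (blank σ′ σ′-bij) × SwapOf σ (blank σ σ-bij) (blank σ′ σ′-bij) σ′
  star-move {σ} {σ′} σ-bij σ′-bij (x , y , xy , inj₁ (σx≡0 , _) , swap@(_ , σ′y≡σx , _))
    with blank-unique σ σ-bij {x} σx≡0 | blank-unique σ′ σ′-bij {y} (trans (cong toℕ σ′y≡σx) σx≡0)
  ... | refl | refl = xy , swap
  star-move {σ} {σ′} σ-bij σ′-bij (x , y , xy , inj₂ (σy≡0 , _) , swap@(σ′x≡σy , _ , _))
    with blank-unique σ σ-bij {y} σy≡0 | blank-unique σ′ σ′-bij {x} (trans (cong toℕ σ′x≡σy) σy≡0)
  ... | refl | refl = SimpleGraph.sym X xy , SwapOf-sym {σ = σ} {σ′} swap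

module LowerBound {N : ℕ} (X : SimpleGraph (suc N)) {K : ℕ} .{{_ : NonZero K}}
  (c : Cycle AllVertices (Adj X) (suc K))
  (contains-all-cycles : ∀ {l} (c′ : Cycle AllVertices (Adj X) l) {u v} →
                         CycleEdge {X = X} c′ u v → CycleEdge {X = X} c u v)
  {L′ : ℕ} (C : Cycle IsBijection (FSAdj X (StarGraph (suc N))) (suc L′)) where
  open Walks X using (NonBacktracking)
  open StarMoves X
  open UniqueCycle X c contains-all-cycles using (k; winds)

  L : ℕ
  L = suc L′

  arrangement : ℕ → Arrangement
  arrangement t = vert C (index t)

  hole : ℕ → Fin (suc N)
  hole t = blank (arrangement t) (isVert C (index t))

  move : ∀ t → Adj X (hole t) (hole (suc t)) ×
               SwapOf (arrangement t) (hole t) (hole (suc t)) (arrangement (suc t))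
  move t = star-move {arrangement t} {arrangement (suc t)}
                     (isVert C (index t)) (isVert C (next (index t))) (adj C (index t))

  swaps : ∀ t → SwapOf (arrangement t) (hole t) (hole (suc t)) (arrangement (suc t))
  swaps t = proj₂ (move t)

  index-L : index L ≡ index {L′} 0
  index-L = index-cong L 0 (n%n≡0 L)

  hole-L+ : ∀ t → hole (L + t) ≡ hole t
  hole-L+ t = cong (λ i → blank (vert C i) (isVert C i))
                   (index-cong (L + t) t (trans (cong (_% L) (+-comm L t)) ([m+n]%n≡m%n t L)))

  -- Two successive moves along the same edge would revisit an arrangement after two steps,
  -- which a cycle of length at least 3 does not do.
  hole-nonBacktracking : NonBacktracking hole
  hole-nonBacktracking = record
    { step      = λ t → proj₁ (move t)
    ; no-return = λ t eq → %-fresh t z<s (len≥3 C)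
                    (trans (cong (_% L) (+-comm t 2)) (index-injective (2 + t) t (inj C (returns t eq))))
    }
    where
    returns : ∀ t → hole (suc (suc t)) ≡ hole t → arrangement (suc (suc t)) ≡ arrangement t
    returns t eq = SwapOf-involutive {σ = arrangement t} {arrangement (suc t)} {arrangement (suc (suc t))} (swaps t)
      (subst (λ h → SwapOf (arrangement (suc t)) (hole (suc t)) h (arrangement (suc (suc t)))) eq (swaps (suc t)))

  hole-winds : Winds k hole
  hole-winds = winds hole-nonBacktracking {L} z<s hole-L+

  open WindsProperties hole-winds using (cancel; injective-%)

  k∣L : k ∣ L
  k∣L = [m+n]%o≡m%o⇒o∣n 0 L k (injective-% {L} {0} (cong (λ i → blank (vert C i) (isVert C i)) index-L))

  K∣L : K ∣ L
  K∣L = [m+n]%o≡m%o⇒o∣n 0 L K (offset-injective {L} {0} offset-L≡offset-0)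
    where
    open Tokens K hole-winds (λ t → lookup (arrangement t)) (λ t → proj₁ (swaps t)) (λ t → proj₂ (proj₂ (swaps t)))
    token-back : lookup (arrangement 0) (hole (L + offset L)) ≡ lookup (arrangement 0) (hole (offset 0))
    token-back = subst (λ σ → lookup σ (hole (L + offset L)) ≡ lookup (arrangement 0) (hole (offset 0)))
                       (cong (vert C) index-L) (token₀ L)
    offset-L≡offset-0 : offset L ≡ offset 0
    offset-L≡offset-0 = cancel 0 (s≤s (offset≤K L)) (s≤s (offset≤K 0))
                               (trans (sym (hole-L+ (offset L))) (proj₁ (isVert C zero) token-back))

  length-bound : k * K ≤ L
  length-bound = ∣⇒≤ (coprime⇒*∣ (suc-coprime K) k∣L K∣L)

module UpperBound {N : ℕ} (X : SimpleGraph (suc N)) {K : ℕ} .{{_ : NonZero K}}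
  (c : Cycle AllVertices (Adj X) (suc K))
  (contains-all-cycles : ∀ {l} (c′ : Cycle AllVertices (Adj X) l) {u v} →
                         CycleEdge {X = X} c′ u v → CycleEdge {X = X} c u v) where
  open StarMoves X using (Arrangement)
  open UniqueCycle X c contains-all-cycles
    using (k; at; at-adj; at-winds; at-fresh; at-+-cong; OnCycle; onCycle?; onCycle⇒at; at-onCycle)
  open WindsProperties at-winds using (cancel; cong-%; injective-%)

  permutation : ℕ → Permutation′ (suc N)
  permutation zero = Permutation.transpose (at 0) zero
  permutation (suc t) = Permutation.transpose (at t) (at (suc t)) ∘ₚ permutation t

  σ : ℕ → Fin (suc N) → Fin (suc N)
  σ t x = permutation t ⟨$⟩ʳ x

  σ-injective : ∀ t {x y} → σ t x ≡ σ t y → x ≡ y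
  σ-injective t eq =
    trans (sym (inverseˡ (permutation t))) (trans (cong (permutation t ⟨$⟩ˡ_) eq) (inverseˡ (permutation t)))

  blank-at : ∀ t → σ t (at t) ≡ zero
  blank-at zero = transpose-at-i (at 0) zero
  blank-at (suc t) = trans (cong (σ t) (transpose-at-j (at t) (at (suc t)))) (blank-at t)

  open Tokens K at-winds σ (λ t → cong (σ t) (transpose-at-i (at t) (at (suc t))))
                          (λ t x x≢ x≢′ → cong (σ t) (transpose-other x≢ x≢′))

  arrangement : ℕ → Arrangement
  arrangement t = tabulate (σ t)

  arrangement-bij : ∀ t → IsBijection (arrangement t)
  arrangement-bij t =
      (λ {x} {y} eq → σ-injective t (trans (sym (lookup∘tabulate (σ t) x)) (trans eq (lookup∘tabulate (σ t) y))))
    , λ y → permutation t ⟨$⟩ˡ y , λ { refl → trans (lookup∘tabulate (σ t) _) (inverseʳ (permutation t)) }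

  fs-step : ∀ t → FSAdj X (StarGraph (suc N)) (arrangement t) (arrangement (suc t))
  fs-step t =
    at t , at (suc t) , at-adj t , inj₁ (cong toℕ blank-t , leaf) , SwapOf-transpose (σ t) (at t) (at (suc t))
    where
    blank-t : lookup (arrangement t) (at t) ≡ zero
    blank-t = trans (lookup∘tabulate (σ t) (at t)) (blank-at t)
    leaf : toℕ (lookup (arrangement t) (at (suc t))) ≢ 0
    leaf eq = at-fresh t z<s (s≤s (>-nonZero⁻¹ K))
      (trans (cong at (+-comm t 1)) (σ-injective t (trans (sym (lookup∘tabulate (σ t) _))
                                                  (trans (Finₚ.toℕ-injective eq) (sym (blank-at t))))))

  M : ℕ
  M = k * K

  instance
    M-nonZero : NonZero M
    M-nonZero = m*n≢0 k K

  at-M+ : ∀ y → at (M + y) ≡ at y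
  at-M+ y = cong-% {M + y} {y}
    (trans (cong (_% k) (+-comm M y)) (trans (cong (λ z → (y + z) % k) (*-comm k K)) ([m+kn]%n≡m%n y K k)))

  at-M : at M ≡ at 0
  at-M = trans (cong at (sym (+-identityʳ M))) (at-M+ 0)

  offset-M+ : ∀ i → offset (M + i) ≡ offset i
  offset-M+ i = cong (λ r → K ∸ r) (trans (cong (_% K) (+-comm M i)) ([m+kn]%n≡m%n i k K))

  offset-K∸ : ∀ {j} → 0 < j → j ≤ K → offset (K ∸ j) ≡ j
  offset-K∸ {j} 0<j j≤K = trans (cong (K ∸_) (m<n⇒m%n≡m (∸-monoʳ-< 0<j j≤K))) (m∸[m∸n]≡n j≤K)

  closes : ∀ x → σ M x ≡ σ 0 x
  closes x with onCycle? x
  ... | no off = unmoved M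
    where
    unmoved : ∀ t → σ t x ≡ σ 0 x
    unmoved zero = refl
    unmoved (suc t) = trans (cong (σ t) (transpose-other (off-at t) (off-at (suc t)))) (unmoved t)
      where
      off-at : ∀ t → x ≢ at t
      off-at t refl = off (at-onCycle t)
  ... | yes on with onCycle⇒at on
  ...   | zero , _ , refl = trans (cong (σ M) (sym at-M)) (trans (blank-at M) (sym (blank-at 0)))
  ...   | suc j , s≤s j<K , refl = begin
    σ M (at (suc j))                                  ≡⟨ cong (σ M) (sym (at-M+ (suc j))) ⟩
    σ M (at (M + suc j))                              ≡⟨ cong (λ o → σ M (at (M + o))) (offset-K∸ z<s j<K) ⟨
    σ M (at (M + offset (K ∸ suc j)))                 ≡⟨ cong (λ o → σ M (at (M + o))) (offset-M+ (K ∸ suc j)) ⟨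
    σ M (at (M + offset (M + (K ∸ suc j))))           ≡⟨ token (K ∸ suc j) M ⟩
    σ 0 (at (offset (K ∸ suc j)))                     ≡⟨ cong (σ 0 ∘ at) (offset-K∸ z<s j<K) ⟩
    σ 0 (at (suc j))                                  ∎
    where open ≡-Reasoning

  arrangement-no-repeat : ∀ t d → t + d < M → arrangement t ≡ arrangement (t + d) → d ≡ 0
  arrangement-no-repeat t zero _ _ = refl
  arrangement-no-repeat t d@(suc _) t+d<M eq =
    ⊥-elim (<⇒≱ (≤-trans (s≤s (m≤n+m d t)) t+d<M) (∣⇒≤ (coprime⇒*∣ (suc-coprime K) k∣d K∣d)))
    where
    σ-eq : ∀ x → σ t x ≡ σ (t + d) x
    σ-eq x = trans (sym (lookup∘tabulate (σ t) x))
                   (trans (cong (λ v → lookup v x) eq) (lookup∘tabulate (σ (t + d)) x))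
    same-blank : at t ≡ at (t + d)
    same-blank = σ-injective t (trans (blank-at t) (sym (trans (σ-eq (at (t + d))) (blank-at (t + d)))))
    k∣d : k ∣ d
    k∣d = [m+n]%o≡m%o⇒o∣n t d k (sym (injective-% {t} {t + d} same-blank))
    same-token : at (t + offset t) ≡ at (t + offset (t + d))
    same-token = σ-injective t (begin
      σ t (at (t + offset t))                  ≡⟨ token₀ t ⟩
      σ 0 (at (offset 0))                      ≡⟨ token₀ (t + d) ⟨
      σ (t + d) (at (t + d + offset (t + d)))  ≡⟨ σ-eq _ ⟨
      σ t (at (t + d + o′))                    ≡⟨ cong (σ t ∘ at) (+-comm (t + d) o′) ⟩
      σ t (at (o′ + (t + d)))                  ≡⟨ cong (σ t) (at-+-cong o′ same-blank) ⟨
      σ t (at (o′ + t))                        ≡⟨ cong (σ t ∘ at) (+-comm o′ t) ⟩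
      σ t (at (t + o′))                        ∎)
      where
      open ≡-Reasoning
      o′ : ℕ
      o′ = offset (t + d)
    K∣d : K ∣ d
    K∣d = [m+n]%o≡m%o⇒o∣n t d K (sym (offset-injective {t} {t + d}
            (cancel t (s≤s (offset≤K t)) (s≤s (offset≤K (t + d))) same-token)))

  arrangement-injective : ∀ {i j} → i < M → j < M → arrangement i ≡ arrangement j → i ≡ j
  arrangement-injective {i} {j} i<M j<M eq with ≤-total i j
  ... | inj₁ i≤j with m≤n⇒∃[o]m+o≡n i≤j
  ...   | d , refl = sym (trans (cong (i +_) (arrangement-no-repeat i d j<M eq)) (+-identityʳ i))
  arrangement-injective {i} {j} i<M j<M eq | inj₂ j≤i with m≤n⇒∃[o]m+o≡n j≤i
  ...   | d , refl = trans (cong (j +_) (arrangement-no-repeat j d i<M (sym eq))) (+-identityʳ j)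

  cycle : Cycle IsBijection (FSAdj X (StarGraph (suc N))) M
  cycle = subst (Cycle IsBijection (FSAdj X (StarGraph (suc N)))) (suc-pred M)
            (sequence→cycle arrangement (pred-mono-≤ (≤-trans (len≥3 c) (m≤m*n k K)))
              (λ i≤ j≤ → arrangement-injective (below-M i≤) (below-M j≤))
              (λ {t} _ → fs-step t) closing arrangement-bij)
    where
    below-M : ∀ {i} → i ≤ pred M → i < M
    below-M {i} i≤ = subst (i <_) (suc-pred M) (s≤s i≤)
    closing : FSAdj X (StarGraph (suc N)) (arrangement (pred M)) (arrangement 0)
    closing = subst (FSAdj X (StarGraph (suc N)) (arrangement (pred M)))
                    (trans (cong arrangement (suc-pred M)) (tabulate-cong closes)) (fs-step (pred M))

proposition4p9 : (n k : ℕ) (X : SimpleGraph n) →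
    Connected X → UniqueCycleOfLength X k →
    GirthFS X (StarGraph n) (k * (k ∸ 1))
proposition4p9 n zero X _ (c , _) with len≥3 c
... | ()
proposition4p9 zero (suc K) X _ (c , _) with vert c zero
... | ()
proposition4p9 (suc N) (suc K) X _ (c , same-edges) =
  UpperBound.cycle X c contains-all-cycles , length-bound
  where
  instance
    K-nonZero : NonZero K
    K-nonZero = >-nonZero (s≤s⁻¹ (≤-trans (s≤s (s≤s z≤n)) (len≥3 c)))
  contains-all-cycles : ∀ {l} (c′ : Cycle AllVertices (Adj X) l) {u v} →
                        CycleEdge {X = X} c′ u v → CycleEdge {X = X} c u v
  contains-all-cycles c′ {u} {v} = proj₂ (same-edges _ c′ u v)
  length-bound : ∀ L → Cycle IsBijection (FSAdj X (StarGraph (suc N))) L → suc K * K ≤ L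
  length-bound zero C with len≥3 C
  ... | ()
  length-bound (suc L′) C = LowerBound.length-bound X c contains-all-cycles C
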